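{- Let $k$ be a positive integer and $0<\alpha\le 1$. Suppose $A$ is an $\alpha$-approximation algorithm for $k$PPE, i.e. a polynomial-time algorithm which on every simple undirected graph $G=(V,E)$ outputs a $k$-pp $\mathcal{P}$ of $G$ with $|E(\mathcal{P})|\ge\alpha|E(\mathcal{Q}')|$ for every $k$-pp $\mathcal{Q}'$ of $G$. Then $A$ is a $((1-\alpha)k+\alpha)$-approximation algorithm for $k$PP, i.e. for every such $G$ its output $\mathcal{P}$ satisfies $|\mathcal{P}|\le((1-\alpha)k+\alpha)\,|\mathcal{Q}|$, where $\mathcal{Q}$ is a $k$-pp of $G$ with the minimum number of paths and $|\cdot|$ denotes the number of paths (connected components).
   Context: A $k^-$-path partition ($k$-pp) of a simple undirected graph $G$ is a spanning subgraph of $G$ in which every connected component is a path with at most $k$ vertices; its size is its number of paths. $k$PP asks for a $k$-pp with the minimum number of paths; $k$PPE asks for a $k$-pp with the maximum number of edges.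
   Formalization: The approximation factor α ranges over the rationals with $0<\alpha\le 1$. -}

module Defs where

open import Data.Nat using (ℕ; _∸_; _≤_)
open import Data.Fin using (Fin)
open import Data.List using (List; []; _∷_; length; map; concat; allFin)
open import Data.Nat.ListAction using (sum)
open import Data.List.Relation.Binary.Permutation.Propositional using (_↭_)
open import Data.List.Relation.Unary.All using (All)
open import Data.Product using (_×_)
open import Data.Unit using (⊤)
open import Data.Empty using (⊥)
open import Relation.Nullary using (¬_)
open import Data.Integer using (+_)
open import Data.Rational using (ℚ; _/_)

record Graph (n : ℕ) : Set₁ where
  field
    Adj   : Fin n → Fin n → Set
    sym   : ∀ {x y} → Adj x y → Adj y x
    irrefl : ∀ x → ¬ Adj x x
open Graph public

IsWalk : ∀ {n} → Graph n → List (Fin n) → Set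
IsWalk G []           = ⊤
IsWalk G (x ∷ [])     = ⊤
IsWalk G (x ∷ y ∷ xs) = Adj G x y × IsWalk G (y ∷ xs)

NonEmpty : ∀ {A : Set} → List A → Set
NonEmpty []      = ⊥
NonEmpty (_ ∷ _) = ⊤

-- A path of G with at most k vertices, given by its vertex sequence
-- (distinctness of vertices is enforced globally by the partition condition).
IsKPath : ∀ {n} → ℕ → Graph n → List (Fin n) → Set
IsKPath k G p = NonEmpty p × (length p ≤ k) × IsWalk G p

record KPP {n : ℕ} (k : ℕ) (G : Graph n) : Set where
  constructor kpp
  field
    paths     : List (List (Fin n))
    arePaths  : All (IsKPath k G) paths
    partition : concat paths ↭ allFin n
open KPP public

size : ∀ {n k} {G : Graph n} → KPP k G → ℕ
size P = length (paths P)

numEdges : ∀ {n k} {G : Graph n} → KPP k G → ℕ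
numEdges P = sum (map (λ p → length p ∸ 1) (paths P))

toℚ : ℕ → ℚ
toℚ m = (+ m) / 1

-- Every k-pp P of an n-vertex graph satisfies |E(P)| + |P| = n, and n ≤ k|Q| for every k-pp Q.
-- Hence |P| = n - |E(P)| ≤ n - α|E(Q)| = (1 - α)n + α|Q| ≤ ((1 - α)k + α)|Q|.
module Submission where

open import Defs
open import Data.Nat using (ℕ; _≥_) renaming (_≤_ to _≤ℕ_)
open import Data.Rational using (ℚ; 0ℚ; 1ℚ; _<_; _≤_; _*_; _+_; _-_)

import Data.Nat as ℕ
import Data.Nat.Properties as ℕ
import Data.Integer as ℤ
import Data.Integer.Properties as ℤ
open import Data.Nat.Coprimality using (1-coprimeTo) renaming (sym to coprime-sym)
open import Data.Nat.ListAction using (sum)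
open import Data.Rational using (-_; NonNegative; nonNegative; toℚᵘ)
open import Data.Rational.Properties
  using (normalize-coprime; toℚᵘ-injective; toℚᵘ-homo-+; toℚᵘ-homo-*; toℚᵘ-cancel-≤;
         +-monoʳ-≤; +-monoˡ-≤; +-inverseʳ; neg-antimono-≤; *-monoˡ-≤-nonNeg; module ≤-Reasoning)
open import Data.Rational.Unnormalised as ℚᵘ using (mkℚᵘ)
open import Data.Rational.Unnormalised.Properties using (≃-sym; module ≃-Reasoning)
open import Data.Rational.Solver using (module +-*-Solver)
open import Data.List using (List; []; _∷_; length; map; concat; allFin)
open import Data.List.Properties using (length-++; length-tabulate)
open import Data.List.Relation.Unary.All as All using (All; []; _∷_)
open import Data.List.Relation.Binary.Permutation.Propositional.Properties using (↭-length)
open import Data.Product using (proj₁; proj₂)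
open import Function using (_∘_)
open import Relation.Binary.PropositionalEquality as ≡
  using (_≡_; refl; trans; cong; cong₂; subst; subst₂)

length-concat : ∀ {A : Set} (xss : List (List A)) → length (concat xss) ≡ sum (map length xss)
length-concat []         = refl
length-concat (xs ∷ xss) = trans (length-++ xs) (cong (length xs ℕ.+_) (length-concat xss))

sum-pred-length+length : ∀ {A : Set} (xss : List (List A)) → All NonEmpty xss →
  sum (map (λ xs → length xs ℕ.∸ 1) xss) ℕ.+ length xss ≡ sum (map length xss)
sum-pred-length+length [] [] = refl
sum-pred-length+length ((_ ∷ xs) ∷ xss) (_ ∷ ne) = begin
  length xs ℕ.+ e ℕ.+ ℕ.suc (length xss)  ≡⟨ ℕ.+-suc (length xs ℕ.+ e) (length xss) ⟩
  ℕ.suc (length xs ℕ.+ e ℕ.+ length xss)  ≡⟨ cong ℕ.suc (ℕ.+-assoc (length xs) e (length xss)) ⟩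
  ℕ.suc (length xs ℕ.+ (e ℕ.+ length xss)) ≡⟨ cong (ℕ.suc ∘ (length xs ℕ.+_)) (sum-pred-length+length xss ne) ⟩
  ℕ.suc (length xs ℕ.+ sum (map length xss)) ∎
  where
  open ≡.≡-Reasoning
  e : ℕ
  e = sum (map (λ xs → length xs ℕ.∸ 1) xss)

sum-length≤*length : ∀ {A : Set} {k} (xss : List (List A)) → All (λ xs → length xs ≤ℕ k) xss →
  sum (map length xss) ≤ℕ k ℕ.* length xss
sum-length≤*length []                  []         = ℕ.z≤n
sum-length≤*length {k = k} (xs ∷ xss) (l≤k ∷ ls) =
  ℕ.≤-trans (ℕ.+-mono-≤ l≤k (sum-length≤*length xss ls)) (ℕ.≤-reflexive (≡.sym (ℕ.*-suc k (length xss))))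

module _ {n k} {G : Graph n} (P : KPP k G) where

  sum-length-paths : sum (map length (paths P)) ≡ n
  sum-length-paths = begin
    sum (map length (paths P)) ≡⟨ length-concat (paths P) ⟨
    length (concat (paths P))  ≡⟨ ↭-length (partition P) ⟩
    length (allFin n)          ≡⟨ length-tabulate (λ i → i) ⟩
    n                          ∎
    where open ≡.≡-Reasoning

  numEdges+size≡n : numEdges P ℕ.+ size P ≡ n
  numEdges+size≡n =
    trans (sum-pred-length+length (paths P) (All.map proj₁ (arePaths P))) sum-length-paths

  n≤k*size : n ≤ℕ k ℕ.* size P
  n≤k*size = subst (_≤ℕ k ℕ.* size P) sum-length-paths
    (sum-length≤*length (paths P) (All.map (proj₁ ∘ proj₂) (arePaths P)))

toℚᵘ-toℚ : ∀ m → toℚᵘ (toℚ m) ≡ mkℚᵘ (ℤ.+ m) 0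
toℚᵘ-toℚ m = cong toℚᵘ (normalize-coprime (coprime-sym (1-coprimeTo m)))

toℚ-+ : ∀ m n → toℚ (m ℕ.+ n) ≡ toℚ m + toℚ n
toℚ-+ m n = toℚᵘ-injective (begin
  toℚᵘ (toℚ (m ℕ.+ n))                         ≡⟨ toℚᵘ-toℚ (m ℕ.+ n) ⟩
  mkℚᵘ (ℤ.+ (m ℕ.+ n)) 0                       ≡⟨ cong (λ i → mkℚᵘ i 0) +[m+n]≡+m*1++n*1 ⟩
  mkℚᵘ (ℤ.+ m) 0 ℚᵘ.+ mkℚᵘ (ℤ.+ n) 0           ≡⟨ cong₂ ℚᵘ._+_ (toℚᵘ-toℚ m) (toℚᵘ-toℚ n) ⟨
  toℚᵘ (toℚ m) ℚᵘ.+ toℚᵘ (toℚ n)               ≈⟨ ≃-sym (toℚᵘ-homo-+ (toℚ m) (toℚ n)) ⟩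
  toℚᵘ (toℚ m + toℚ n)                         ∎)
  where
  open ≃-Reasoning
  +[m+n]≡+m*1++n*1 : ℤ.+ (m ℕ.+ n) ≡ ℤ.+ m ℤ.* ℤ.1ℤ ℤ.+ ℤ.+ n ℤ.* ℤ.1ℤ
  +[m+n]≡+m*1++n*1 = trans (ℤ.pos-+ m n) (≡.sym (cong₂ ℤ._+_ (ℤ.*-identityʳ (ℤ.+ m)) (ℤ.*-identityʳ (ℤ.+ n))))

toℚ-* : ∀ m n → toℚ (m ℕ.* n) ≡ toℚ m * toℚ n
toℚ-* m n = toℚᵘ-injective (begin
  toℚᵘ (toℚ (m ℕ.* n))                         ≡⟨ toℚᵘ-toℚ (m ℕ.* n) ⟩
  mkℚᵘ (ℤ.+ (m ℕ.* n)) 0                       ≡⟨ cong (λ i → mkℚᵘ i 0) (ℤ.pos-* m n) ⟩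
  mkℚᵘ (ℤ.+ m) 0 ℚᵘ.* mkℚᵘ (ℤ.+ n) 0           ≡⟨ cong₂ ℚᵘ._*_ (toℚᵘ-toℚ m) (toℚᵘ-toℚ n) ⟨
  toℚᵘ (toℚ m) ℚᵘ.* toℚᵘ (toℚ n)               ≈⟨ ≃-sym (toℚᵘ-homo-* (toℚ m) (toℚ n)) ⟩
  toℚᵘ (toℚ m * toℚ n)                         ∎)
  where open ≃-Reasoning

toℚ-mono-≤ : ∀ {m n} → m ≤ℕ n → toℚ m ≤ toℚ n
toℚ-mono-≤ {m} {n} m≤n = toℚᵘ-cancel-≤
  (subst₂ ℚᵘ._≤_ (≡.sym (toℚᵘ-toℚ m)) (≡.sym (toℚᵘ-toℚ n))
    (ℚᵘ.*≤* (ℤ.*-monoʳ-≤-nonNeg ℤ.1ℤ (ℤ.+≤+ m≤n))))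

0≤1-α : ∀ {α} → α ≤ 1ℚ → NonNegative (1ℚ - α)
0≤1-α {α} α≤1 = nonNegative (subst (_≤ 1ℚ - α) (+-inverseʳ α) (+-monoˡ-≤ (- α) α≤1))

size-bound : ∀ {α p e q f N K : ℚ} → α ≤ 1ℚ →
  e + p ≡ N → f + q ≡ N → α * f ≤ e → N ≤ K * q →
  p ≤ ((1ℚ - α) * K + α) * q
size-bound {α} {p} {e} {q} {f} {N} {K} α≤1 e+p≡N f+q≡N αf≤e N≤Kq = begin
  p                            ≡⟨ solve 2 (λ e p → p := (e :+ p) :- e) refl e p ⟩
  (e + p) - e                  ≡⟨ cong (_- e) e+p≡N ⟩
  N - e                        ≤⟨ +-monoʳ-≤ N (neg-antimono-≤ αf≤e) ⟩
  N - α * f                    ≡⟨ cong (_- α * f) f+q≡N ⟨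
  (f + q) - α * f              ≡⟨ solve 3 (λ α f q → (f :+ q) :- α :* f := (con 1ℚ :- α) :* (f :+ q) :+ α :* q) refl α f q ⟩
  (1ℚ - α) * (f + q) + α * q   ≡⟨ cong (λ x → (1ℚ - α) * x + α * q) f+q≡N ⟩
  (1ℚ - α) * N + α * q         ≤⟨ +-monoˡ-≤ (α * q) (*-monoˡ-≤-nonNeg (1ℚ - α) {{0≤1-α α≤1}} N≤Kq) ⟩
  (1ℚ - α) * (K * q) + α * q   ≡⟨ solve 3 (λ α K q → (con 1ℚ :- α) :* (K :* q) :+ α :* q := ((con 1ℚ :- α) :* K :+ α) :* q) refl α K q ⟩
  ((1ℚ - α) * K + α) * q       ∎
  where
  open ≤-Reasoning
  open +-*-Solver

lemma1 : (k : ℕ) → k ≥ 1 → (α : ℚ) → 0ℚ < α → α ≤ 1ℚ →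
    (A : ∀ {n} (G : Graph n) → KPP k G) →
    (∀ {n} (G : Graph n) (Q' : KPP k G) → α * toℚ (numEdges Q') ≤ toℚ (numEdges (A G))) →
    ∀ {n} (G : Graph n) (Q : KPP k G) → (∀ (R : KPP k G) → size Q ≤ℕ size R) →
    toℚ (size (A G)) ≤ ((1ℚ - α) * toℚ k + α) * toℚ (size Q)
lemma1 k _ α _ α≤1 A A-approx {n} G Q _ =
  size-bound α≤1 (edges+size (A G)) (edges+size Q) (A-approx G Q) n≤kq
  where
  edges+size : (P : KPP k G) → toℚ (numEdges P) + toℚ (size P) ≡ toℚ n
  edges+size P = trans (≡.sym (toℚ-+ (numEdges P) (size P))) (cong toℚ (numEdges+size≡n P))
  n≤kq : toℚ n ≤ toℚ k * toℚ (size Q)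
  n≤kq = subst (toℚ n ≤_) (toℚ-* k (size Q)) (toℚ-mono-≤ (n≤k*size Q))
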